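{- Let $H$ be a graph with at least one edge, let $F$ be a copy of $K_n$ with $n\geq 5|V(H)|$, and let $u,v$ be two distinct vertices of $F$. Suppose the edges of $F$ are colored (with colors from $\mathbb{N}$) so that $F-\{u,v\}$ is rainbow and all the edges between $\{u,v\}$ and $V(F)\setminus\{u,v\}$ form a rainbow copy of $K_{2,n-2}$. Then no matter what color is assigned to the edge $uv$, $F$ contains a rainbow copy of $H$ containing the edge $uv$.
   Context: All graphs are finite and simple. A subgraph of an edge-colored graph is rainbow if its edges have pairwise distinct colors. -}

module Defs where

open import Data.Nat using (ℕ)
open import Data.Fin using (Fin)
open import Data.Product using (_×_; Σ; ∃; ∃-syntax)
open import Data.Sum using (_⊎_)
open import Relation.Nullary using (¬_)
open import Relation.Binary.PropositionalEquality using (_≡_; _≢_)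
open import Function.Definitions using (Injective)

record SimpleGraph (m : ℕ) : Set₁ where
  field
    Adj     : Fin m → Fin m → Set
    symm    : ∀ {a b} → Adj a b → Adj b a
    irrefl  : ∀ {a} → ¬ Adj a a

open SimpleGraph public

HasEdge : ∀ {m} → SimpleGraph m → Set
HasEdge H = ∃[ a ] ∃[ b ] Adj H a b

SameEdge : ∀ {k} → Fin k → Fin k → Fin k → Fin k → Set
SameEdge a b a' b' = (a ≡ a' × b ≡ b') ⊎ (a ≡ b' × b ≡ a')

-- An edge colouring of the complete graph K_n on Fin n (colours in ℕ):
-- a colour for each ordered pair, symmetric; diagonal values are irrelevant.
SymColouring : ℕ → Set
SymColouring n = Σ (Fin n → Fin n → ℕ) λ c → ∀ i j → c i j ≡ c j i

-- The set of edges of K_n described by P (each edge listed in at least one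
-- orientation) is rainbow under c: distinct edges get distinct colours.
RainbowEdges : ∀ {n} → (Fin n → Fin n → ℕ) → (Fin n → Fin n → Set) → Set
RainbowEdges c P = ∀ i j k l → i ≢ j → k ≢ l → P i j → P k l →
                   c i j ≡ c k l → SameEdge i j k l

OutsideEdge : ∀ {n} → Fin n → Fin n → Fin n → Fin n → Set
OutsideEdge u v i j = (i ≢ u × i ≢ v) × (j ≢ u × j ≢ v)

CrossEdge : ∀ {n} → Fin n → Fin n → Fin n → Fin n → Set
CrossEdge u v i j = (i ≡ u ⊎ i ≡ v) × (j ≢ u × j ≢ v)

RainbowCopyThrough : ∀ {m n} → SimpleGraph m → (Fin n → Fin n → ℕ) →
                     Fin n → Fin n → Set
RainbowCopyThrough {m} {n} H c u v =
  Σ (Fin m → Fin n) λ φ →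
    Injective _≡_ _≡_ φ ×
    (∀ a b a' b' → Adj H a b → Adj H a' b' →
       c (φ a) (φ b) ≡ c (φ a') (φ b') → SameEdge a b a' b') ×
    (∃[ a ] ∃[ b ] (Adj H a b × φ a ≡ u × φ b ≡ v))

-- It suffices to find ∣V(H)∣ vertices S outside {u,v} such that the complete graph on {u,v} ∪ S
-- is rainbow: an edge of H is then sent onto uv and the remaining vertices of H into S.  Edges
-- inside S and edges from {u,v} to S are rainbow by hypothesis, so only coincidences between
-- different kinds of edges must be avoided.  The colour of uv lies on at most one cross edge and
-- at most one inner edge, which excludes two vertices besides u and v.  A cross edge xw shares
-- its colour with at most one inner edge; an arc from w to a designated endpoint of that edge
-- gives a digraph of out-degree at most 2 in which S must be independent.  Its underlying graph
-- has average degree at most 4, so repeatedly keeping a vertex of minimum degree and discarding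
-- its neighbours yields an independent set containing a fifth of the n - 4 remaining vertices,
-- hence at least ∣V(H)∣ of them since n ≥ 5∣V(H)∣.

module Submission where

open import Data.Bool using (Bool; true; false; T; _∧_; _∨_; not)
open import Data.Bool.Properties using (T-∨)
open import Data.Empty using (⊥; ⊥-elim)
open import Data.Fin using (Fin; zero; suc; toℕ)
open import Data.Fin.Properties using (_≟_; any?) renaming (suc-injective to Fin-suc-injective)
import Data.Fin.Properties as Finₚ
open import Data.Nat using (ℕ; zero; suc; _+_; _*_; _≤_; _<_; z≤n; s≤s; >-nonZero)
import Data.Nat as ℕ
open import Data.Nat.Induction using (<-wellFounded)
open import Data.Nat.Properties hiding (_≟_)
open import Algebra.Properties.Semiring.Sum +-*-semiring
  using (sum; ∑-comm; ∑-distrib-+; *-distribˡ-sum; *-distribʳ-sum; sum-cong-≗; sum-replicate-zero)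
open import Data.Product using (Σ; _×_; _,_; proj₁; proj₂; ∃-syntax)
import Data.Product as Product
open import Data.Sum using (_⊎_; inj₁; inj₂; [_,_])
import Data.Sum as Sum
open import Data.Unit using (tt)
open import Data.Vec.Functional using (_∷_; updateAt)
open import Data.Vec.Functional.Properties using (updateAt-updates; updateAt-minimal)
open import Function using (_∘_; const; Equivalence)
open import Function.Definitions using (Injective)
open import Induction.WellFounded using (Acc; acc)
open import Relation.Binary.Definitions using (tri<; tri≈; tri>)
open import Relation.Binary.PropositionalEquality using (_≡_; _≢_; refl; sym; trans; cong; subst; module ≡-Reasoning)
open import Relation.Nullary using (¬_; Dec; yes; no; contradiction)
open import Relation.Nullary.Decidable using (⌊_⌋; T?; _×-dec_; _⊎-dec_; ¬?; toWitness; fromWitness)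
open import Relation.Unary using (Decidable)
open import Relation.Unary.Properties using (_∪?_)

open import Defs

private variable
  N : ℕ

-- Counting subsets of Fin N

𝟙 : Bool → ℕ
𝟙 false = 0
𝟙 true  = 1

𝟙-mono : ∀ {a b} → (T a → T b) → 𝟙 a ≤ 𝟙 b
𝟙-mono {false}         _   = z≤n
𝟙-mono {true} {true}   _   = ≤-refl
𝟙-mono {true} {false} a⇒b = ⊥-elim (a⇒b tt)

𝟙-∨ : ∀ a b → 𝟙 (a ∨ b) ≤ 𝟙 a + 𝟙 b
𝟙-∨ false _ = ≤-refl
𝟙-∨ true  _ = s≤s z≤n

𝟙-∨-disjoint : ∀ a b → (T a → T b → ⊥) → 𝟙 (a ∨ b) ≡ 𝟙 a + 𝟙 b
𝟙-∨-disjoint false _     _        = refl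
𝟙-∨-disjoint true  false _        = refl
𝟙-∨-disjoint true  true  disjoint = ⊥-elim (disjoint tt tt)

𝟙-∧ : ∀ a b → 𝟙 (a ∧ b) ≡ 𝟙 a * 𝟙 b
𝟙-∧ false _ = refl
𝟙-∧ true  b = sym (+-identityʳ (𝟙 b))

𝟙-*-mono : ∀ a {x y} → (T a → x ≤ y) → 𝟙 a * x ≤ 𝟙 a * y
𝟙-*-mono false _   = z≤n
𝟙-*-mono true  x≤y = +-monoˡ-≤ 0 (x≤y tt)

sum-mono-≤ : {f g : Fin N → ℕ} → (∀ i → f i ≤ g i) → sum f ≤ sum g
sum-mono-≤ {zero}  _   = z≤n
sum-mono-≤ {suc N} f≤g = +-mono-≤ (f≤g zero) (sum-mono-≤ (f≤g ∘ suc))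

sum-const-1 : ∀ N → sum {N} (λ _ → 1) ≡ N
sum-const-1 zero    = refl
sum-const-1 (suc N) = cong suc (sum-const-1 N)

infix  4 _∈_ _⊆_
infixl 6 _∩_ _─_
infixl 5 _∪_

_∈_ : Fin N → (Fin N → Bool) → Set
x ∈ A = T (A x)

_⊆_ : (Fin N → Bool) → (Fin N → Bool) → Set
A ⊆ B = ∀ {x} → x ∈ A → x ∈ B

_∪_ _∩_ _─_ : (Fin N → Bool) → (Fin N → Bool) → Fin N → Bool
(A ∪ B) x = A x ∨ B x
(A ∩ B) x = A x ∧ B x
(A ─ B) x = A x ∧ not (B x)

∁ : (Fin N → Bool) → Fin N → Bool
∁ A x = not (A x)

∅ : Fin N → Bool
∅ _ = false

⁅_⁆ : Fin N → Fin N → Bool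
⁅ w ⁆ x = ⌊ x ≟ w ⌋

∣_∣ : (Fin N → Bool) → ℕ
∣ A ∣ = sum (𝟙 ∘ A)

∑[∈]-syntax : (Fin N → Bool) → (Fin N → ℕ) → ℕ
∑[∈]-syntax A f = sum (λ x → 𝟙 (A x) * f x)

syntax ∑[∈]-syntax A (λ x → e) = ∑[ x ∈ A ] e

module _ (A B : Fin N → Bool) {x : Fin N} where

  x∈A∪B⁻ : x ∈ A ∪ B → x ∈ A ⊎ x ∈ B
  x∈A∪B⁻ = Equivalence.to T-∨

  x∈A∪B⁺ : x ∈ A ⊎ x ∈ B → x ∈ A ∪ B
  x∈A∪B⁺ = Equivalence.from T-∨

  x∈A─B⁻ : x ∈ A ─ B → x ∈ A × ¬ x ∈ B
  x∈A─B⁻ x∈A─B with A x | B x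
  ... | true | false = tt , λ ()

x∈∁A⁻ : ∀ (A : Fin N → Bool) {x} → x ∈ ∁ A → ¬ x ∈ A
x∈∁A⁻ A {x} x∈∁A with A x
... | false = λ ()

x∈⁅w⁆⇒x≡w : ∀ {x w : Fin N} → x ∈ ⁅ w ⁆ → x ≡ w
x∈⁅w⁆⇒x≡w = toWitness

A─B⊆A : ∀ (A B : Fin N → Bool) → A ─ B ⊆ A
A─B⊆A A B = proj₁ ∘ x∈A─B⁻ A B

⁅w⁆∪B⊆A : ∀ {w : Fin N} (A B : Fin N → Bool) → w ∈ A → B ⊆ A → ⁅ w ⁆ ∪ B ⊆ A
⁅w⁆∪B⊆A {w = w} A B w∈A B⊆A x∈ with x∈A∪B⁻ ⁅ w ⁆ B x∈
... | inj₁ x∈⁅w⁆ rewrite x∈⁅w⁆⇒x≡w x∈⁅w⁆ = w∈A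
... | inj₂ x∈B = B⊆A x∈B

A⊆B⇒∣A∣≤∣B∣ : ∀ (A B : Fin N → Bool) → A ⊆ B → ∣ A ∣ ≤ ∣ B ∣
A⊆B⇒∣A∣≤∣B∣ A B A⊆B = sum-mono-≤ (λ x → 𝟙-mono (A⊆B {x}))

∣A∪B∣≤∣A∣+∣B∣ : ∀ (A B : Fin N → Bool) → ∣ A ∪ B ∣ ≤ ∣ A ∣ + ∣ B ∣
∣A∪B∣≤∣A∣+∣B∣ A B =
  ≤-trans (sum-mono-≤ (λ x → 𝟙-∨ (A x) (B x))) (≤-reflexive (∑-distrib-+ (𝟙 ∘ A) (𝟙 ∘ B)))

∣A∪B∣≡∣A∣+∣B∣ : ∀ (A B : Fin N → Bool) → (∀ {x} → x ∈ A → x ∈ B → ⊥) →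
                ∣ A ∪ B ∣ ≡ ∣ A ∣ + ∣ B ∣
∣A∪B∣≡∣A∣+∣B∣ A B disjoint =
  trans (sum-cong-≗ (λ x → 𝟙-∨-disjoint (A x) (B x) disjoint)) (∑-distrib-+ (𝟙 ∘ A) (𝟙 ∘ B))

∣∁A∣+∣A∣≡N : ∀ (A : Fin N → Bool) → ∣ ∁ A ∣ + ∣ A ∣ ≡ N
∣∁A∣+∣A∣≡N {N} A = begin
  ∣ ∁ A ∣ + ∣ A ∣     ≡⟨ ∣A∪B∣≡∣A∣+∣B∣ (∁ A) A (x∈∁A⁻ A) ⟨
  ∣ ∁ A ∪ A ∣         ≡⟨ sum-cong-≗ (λ x → 𝟙-excluded-middle (A x)) ⟩
  sum {N} (λ _ → 1)   ≡⟨ sum-const-1 N ⟩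
  N                   ∎
  where
  open ≡-Reasoning
  𝟙-excluded-middle : ∀ a → 𝟙 (not a ∨ a) ≡ 1
  𝟙-excluded-middle false = refl
  𝟙-excluded-middle true  = refl

∣∅∣≡0 : ∣ ∅ {N} ∣ ≡ 0
∣∅∣≡0 {N} = sum-replicate-zero N

∣⁅w⁆∣≡1 : ∀ (w : Fin N) → ∣ ⁅ w ⁆ ∣ ≡ 1
∣⁅w⁆∣≡1 {suc N} zero    = cong suc (∣∅∣≡0 {N})
∣⁅w⁆∣≡1 {suc N} (suc w) = trans (sum-cong-≗ (λ x → cong 𝟙 (⌊suc≟suc⌋ x))) (∣⁅w⁆∣≡1 w)
  where
  ⌊suc≟suc⌋ : ∀ x → ⌊ suc x ≟ suc w ⌋ ≡ ⌊ x ≟ w ⌋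
  ⌊suc≟suc⌋ x with x ≟ w
  ... | yes _ = refl
  ... | no  _ = refl

∣P∣≤1 : ∀ {P : Fin N → Set} (P? : Decidable P) → (∀ {x y} → P x → P y → x ≡ y) →
        ∣ ⌊_⌋ ∘ P? ∣ ≤ 1
∣P∣≤1 {N} P? unique with any? P?
... | yes (x , Px) = begin
  ∣ ⌊_⌋ ∘ P? ∣  ≤⟨ A⊆B⇒∣A∣≤∣B∣ (⌊_⌋ ∘ P?) ⁅ x ⁆ (λ Py → fromWitness (unique (toWitness Py) Px)) ⟩
  ∣ ⁅ x ⁆ ∣     ≡⟨ ∣⁅w⁆∣≡1 x ⟩
  1             ∎
  where open ≤-Reasoning
... | no  ∄P = begin
  ∣ ⌊_⌋ ∘ P? ∣  ≤⟨ A⊆B⇒∣A∣≤∣B∣ (⌊_⌋ ∘ P?) ∅ (λ {y} Py → ∄P (y , toWitness Py)) ⟩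
  ∣ ∅ {N} ∣     ≡⟨ ∣∅∣≡0 {N} ⟩
  0             ≤⟨ z≤n ⟩
  1             ∎
  where open ≤-Reasoning

∣P∣≤a∧∣Q∣≤b⇒∣P∪Q∣≤a+b : ∀ {P Q : Fin N → Set} (P? : Decidable P) (Q? : Decidable Q) {a b} →
                         ∣ ⌊_⌋ ∘ P? ∣ ≤ a → ∣ ⌊_⌋ ∘ Q? ∣ ≤ b → ∣ ⌊_⌋ ∘ (P? ∪? Q?) ∣ ≤ a + b
∣P∣≤a∧∣Q∣≤b⇒∣P∪Q∣≤a+b P? Q? {a} {b} ∣P∣≤a ∣Q∣≤b = begin
  ∣ ⌊_⌋ ∘ (P? ∪? Q?) ∣          ≤⟨ A⊆B⇒∣A∣≤∣B∣ (⌊_⌋ ∘ (P? ∪? Q?)) (⌊_⌋ ∘ P? ∪ ⌊_⌋ ∘ Q?)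
                                    (x∈A∪B⁺ (⌊_⌋ ∘ P?) (⌊_⌋ ∘ Q?) ∘ Sum.map fromWitness fromWitness ∘ toWitness) ⟩
  ∣ ⌊_⌋ ∘ P? ∪ ⌊_⌋ ∘ Q? ∣       ≤⟨ ∣A∪B∣≤∣A∣+∣B∣ (⌊_⌋ ∘ P?) (⌊_⌋ ∘ Q?) ⟩
  ∣ ⌊_⌋ ∘ P? ∣ + ∣ ⌊_⌋ ∘ Q? ∣   ≤⟨ +-mono-≤ ∣P∣≤a ∣Q∣≤b ⟩
  a + b                         ∎
  where open ≤-Reasoning

∑∈-mono : ∀ (A : Fin N → Bool) {f g : Fin N → ℕ} → (∀ {x} → x ∈ A → f x ≤ g x) →
          ∑[ x ∈ A ] f x ≤ ∑[ x ∈ A ] g x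
∑∈-mono A f≤g = sum-mono-≤ (λ x → 𝟙-*-mono (A x) (f≤g {x}))

∑∈-const : ∀ (A : Fin N → Bool) k → ∑[ x ∈ A ] k ≡ ∣ A ∣ * k
∑∈-const A k = sym (*-distribʳ-sum k (𝟙 ∘ A))

∃-≤-average : ∀ (A : Fin N → Bool) (f : Fin N → ℕ) k → 0 < ∣ A ∣ →
              ∑[ x ∈ A ] f x ≤ ∣ A ∣ * k → ∃[ x ] x ∈ A × f x ≤ k
∃-≤-average A f k ∣A∣>0 ∑f≤ with any? (λ x → T? (A x) ×-dec (f x ≤? k))
... | yes found = found
... | no  none  = contradiction (*-cancelˡ-≤ ∣ A ∣ {{>-nonZero ∣A∣>0}} (begin
  ∣ A ∣ * suc k     ≡⟨ ∑∈-const A (suc k) ⟨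
  ∑[ x ∈ A ] suc k  ≤⟨ ∑∈-mono A (λ {x} x∈A → ≰⇒> (λ fx≤k → none (x , x∈A , fx≤k))) ⟩
  ∑[ x ∈ A ] f x    ≤⟨ ∑f≤ ⟩
  ∣ A ∣ * k         ∎)) (n≮n k)
  where open ≤-Reasoning

m≤∣S∣⇒injection : ∀ {N m} (S : Fin N → Bool) → m ≤ ∣ S ∣ →
                  Σ (Fin m → Fin N) λ g → Injective _≡_ _≡_ g × (∀ i → g i ∈ S)
m≤∣S∣⇒injection {m = zero} S _ = (λ ()) , (λ { {()} }) , (λ ())
m≤∣S∣⇒injection {suc N} {suc m} S m<∣S∣ with S zero in S0
... | false = let g , g-injective , g∈S = m≤∣S∣⇒injection (S ∘ suc) m<∣S∣ in
  suc ∘ g , g-injective ∘ Fin-suc-injective , g∈S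
... | true  = let g , g-injective , g∈S = m≤∣S∣⇒injection (S ∘ suc) (≤-pred m<∣S∣) in
  zero ∷ suc ∘ g , injective g-injective , λ { zero → subst T (sym S0) _ ; (suc i) → g∈S i }
  where
  injective : ∀ {g : Fin m → Fin N} → Injective _≡_ _≡_ g → Injective _≡_ _≡_ (zero ∷ suc ∘ g)
  injective g-injective {zero}  {zero}  _  = refl
  injective g-injective {zero}  {suc _} ()
  injective g-injective {suc _} {zero}  ()
  injective g-injective {suc i} {suc j} eq = cong suc (g-injective (Fin-suc-injective eq))

-- Independent sets in digraphs of bounded out-degree

module BoundedOutdegree {N : ℕ} {R : Fin N → Fin N → Set} (R? : ∀ w z → Dec (R w z))
                        (d : ℕ) (outdegree≤d : ∀ w → ∣ ⌊_⌋ ∘ R? w ∣ ≤ d) where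

  successors predecessors neighbours closedNeighbourhood : Fin N → Fin N → Bool
  successors   w z = ⌊ R? w z ⌋
  predecessors w z = ⌊ R? z w ⌋
  neighbours   w   = successors w ∪ predecessors w
  closedNeighbourhood w = ⁅ w ⁆ ∪ neighbours w

  degree : (Fin N → Bool) → Fin N → ℕ
  degree A w = ∣ A ∩ neighbours w ∣

  ∑indegree≡∑outdegree : ∀ A → sum (λ w → ∣ A ∩ predecessors w ∣) ≡ ∑[ z ∈ A ] ∣ successors z ∣
  ∑indegree≡∑outdegree A = begin
    sum (λ w → sum (λ z → 𝟙 (A z ∧ ⌊ R? z w ⌋)))    ≡⟨ sum-cong-≗ (λ w → sum-cong-≗ (λ z → 𝟙-∧ (A z) ⌊ R? z w ⌋)) ⟩
    sum (λ w → sum (λ z → 𝟙 (A z) * 𝟙 ⌊ R? z w ⌋))  ≡⟨ ∑-comm (λ w z → 𝟙 (A z) * 𝟙 ⌊ R? z w ⌋) ⟩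
    sum (λ z → sum (λ w → 𝟙 (A z) * 𝟙 ⌊ R? z w ⌋))  ≡⟨ sum-cong-≗ (λ z → *-distribˡ-sum (𝟙 (A z)) (λ w → 𝟙 ⌊ R? z w ⌋)) ⟨
    ∑[ z ∈ A ] ∣ successors z ∣                      ∎
    where open ≡-Reasoning

  degree≤outdegree+indegree : ∀ A w → degree A w ≤ ∣ successors w ∣ + ∣ A ∩ predecessors w ∣
  degree≤outdegree+indegree A w = ≤-trans (A⊆B⇒∣A∣≤∣B∣ _ _ (λ {z} → ∧∨⊆ (A z) (successors w z) (predecessors w z)))
                        (∣A∪B∣≤∣A∣+∣B∣ (successors w) (A ∩ predecessors w))
    where
    ∧∨⊆ : ∀ a s p → T (a ∧ (s ∨ p)) → T (s ∨ (a ∧ p))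
    ∧∨⊆ true  true  _ _ = tt
    ∧∨⊆ true  false _ p = p

  ∑degree≤ : ∀ A → ∑[ w ∈ A ] degree A w ≤ ∣ A ∣ * (2 * d)
  ∑degree≤ A = begin
    ∑[ w ∈ A ] degree A w
      ≤⟨ sum-mono-≤ (λ w → 𝟙-*-≤ (A w) (degree≤outdegree+indegree A w)) ⟩
    sum (λ w → 𝟙 (A w) * ∣ successors w ∣ + ∣ A ∩ predecessors w ∣)
      ≡⟨ ∑-distrib-+ (λ w → 𝟙 (A w) * ∣ successors w ∣) (λ w → ∣ A ∩ predecessors w ∣) ⟩
    ∑[ w ∈ A ] ∣ successors w ∣ + sum (λ w → ∣ A ∩ predecessors w ∣)
      ≡⟨ cong (∑[ w ∈ A ] ∣ successors w ∣ +_) (∑indegree≡∑outdegree A) ⟩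
    ∑[ w ∈ A ] ∣ successors w ∣ + ∑[ w ∈ A ] ∣ successors w ∣
      ≤⟨ +-mono-≤ ∑outdegree≤ ∑outdegree≤ ⟩
    ∣ A ∣ * d + ∣ A ∣ * d
      ≡⟨ *-distribˡ-+ ∣ A ∣ d d ⟨
    ∣ A ∣ * (d + d)
      ≡⟨ cong (λ k → ∣ A ∣ * (d + k)) (+-identityʳ d) ⟨
    ∣ A ∣ * (2 * d)
      ∎
    where
    open ≤-Reasoning
    𝟙-*-≤ : ∀ a {x y z} → x ≤ y + z → 𝟙 a * x ≤ 𝟙 a * y + z
    𝟙-*-≤ false _ = z≤n
    𝟙-*-≤ true {x} {y} {z} x≤y+z rewrite +-identityʳ x | +-identityʳ y = x≤y+z
    ∑outdegree≤ : ∑[ w ∈ A ] ∣ successors w ∣ ≤ ∣ A ∣ * d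
    ∑outdegree≤ = ≤-trans (∑∈-mono A (λ {w} _ → outdegree≤d w)) (≤-reflexive (∑∈-const A d))

  low-degree-vertex : ∀ A → 0 < ∣ A ∣ → ∃[ w ] w ∈ A × degree A w ≤ 2 * d
  low-degree-vertex A ∣A∣>0 = ∃-≤-average A (degree A) (2 * d) ∣A∣>0 (∑degree≤ A)

  Independent : (Fin N → Bool) → Set
  Independent S = ∀ {x y} → x ∈ S → y ∈ S → x ≢ y → ¬ R x y

  LargeIndependentSubset : (Fin N → Bool) → (Fin N → Bool) → Set
  LargeIndependentSubset A S = S ⊆ A × Independent S × ∣ A ∣ ≤ suc (2 * d) * ∣ S ∣

  x∈⁅w⁆⇒x∉A─N[w] : ∀ A w {x} → x ∈ ⁅ w ⁆ → ¬ x ∈ A ─ closedNeighbourhood w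
  x∈⁅w⁆⇒x∉A─N[w] A w x∈⁅w⁆ x∈A′ =
    proj₂ (x∈A─B⁻ A (closedNeighbourhood w) x∈A′) (x∈A∪B⁺ ⁅ w ⁆ (neighbours w) (inj₁ x∈⁅w⁆))

  ∣A─N[w]∣<∣A∣ : ∀ A w → w ∈ A → ∣ A ─ closedNeighbourhood w ∣ < ∣ A ∣
  ∣A─N[w]∣<∣A∣ A w w∈A = begin
    suc ∣ A′ ∣           ≡⟨ cong (_+ ∣ A′ ∣) (∣⁅w⁆∣≡1 w) ⟨
    ∣ ⁅ w ⁆ ∣ + ∣ A′ ∣    ≡⟨ ∣A∪B∣≡∣A∣+∣B∣ ⁅ w ⁆ A′ (x∈⁅w⁆⇒x∉A─N[w] A w) ⟨
    ∣ ⁅ w ⁆ ∪ A′ ∣        ≤⟨ A⊆B⇒∣A∣≤∣B∣ (⁅ w ⁆ ∪ A′) A (⁅w⁆∪B⊆A A A′ w∈A (A─B⊆A A (closedNeighbourhood w))) ⟩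
    ∣ A ∣                 ∎
    where
    open ≤-Reasoning
    A′ = A ─ closedNeighbourhood w

  ∣A∣≤1+degree+∣A─N[w]∣ : ∀ A w → ∣ A ∣ ≤ suc (degree A w) + ∣ A ─ closedNeighbourhood w ∣
  ∣A∣≤1+degree+∣A─N[w]∣ A w = begin
    ∣ A ∣                                  ≤⟨ A⊆B⇒∣A∣≤∣B∣ A (⁅ w ⁆ ∪ A ∩ neighbours w ∪ A′)
                                                (λ {x} → covers (A x) (⁅ w ⁆ x) (neighbours w x)) ⟩
    ∣ ⁅ w ⁆ ∪ A ∩ neighbours w ∪ A′ ∣      ≤⟨ ∣A∪B∣≤∣A∣+∣B∣ (⁅ w ⁆ ∪ A ∩ neighbours w) A′ ⟩
    ∣ ⁅ w ⁆ ∪ A ∩ neighbours w ∣ + ∣ A′ ∣  ≤⟨ +-monoˡ-≤ ∣ A′ ∣ (∣A∪B∣≤∣A∣+∣B∣ ⁅ w ⁆ (A ∩ neighbours w)) ⟩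
    ∣ ⁅ w ⁆ ∣ + degree A w + ∣ A′ ∣        ≡⟨ cong (λ k → k + degree A w + ∣ A′ ∣) (∣⁅w⁆∣≡1 w) ⟩
    suc (degree A w) + ∣ A′ ∣              ∎
    where
    open ≤-Reasoning
    A′ = A ─ closedNeighbourhood w
    covers : ∀ a e n → T a → T ((e ∨ a ∧ n) ∨ a ∧ not (e ∨ n))
    covers true true  _     _ = tt
    covers true false true  _ = tt
    covers true false false _ = tt

  add-vertex : ∀ A w → w ∈ A → degree A w ≤ 2 * d →
               ∀ S → LargeIndependentSubset (A ─ closedNeighbourhood w) S →
               LargeIndependentSubset A (⁅ w ⁆ ∪ S)
  add-vertex A w w∈A deg≤2d S (S⊆A′ , S-independent , ∣A′∣≤) =
    ⁅w⁆∪B⊆A A S w∈A (A─B⊆A A (closedNeighbourhood w) ∘ S⊆A′) , independent , bound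
    where
    open ≤-Reasoning
    A′ = A ─ closedNeighbourhood w

    non-adjacent : ∀ {x} → x ∈ S → ¬ x ∈ neighbours w
    non-adjacent x∈S x∈nbd =
      proj₂ (x∈A─B⁻ A (closedNeighbourhood w) (S⊆A′ x∈S)) (x∈A∪B⁺ ⁅ w ⁆ (neighbours w) (inj₂ x∈nbd))

    independent : Independent (⁅ w ⁆ ∪ S)
    independent {x} {y} x∈ y∈ x≢y with x∈A∪B⁻ ⁅ w ⁆ S x∈ | x∈A∪B⁻ ⁅ w ⁆ S y∈
    ... | inj₁ x∈⁅w⁆ | inj₁ y∈⁅w⁆ = ⊥-elim (x≢y (trans (x∈⁅w⁆⇒x≡w x∈⁅w⁆) (sym (x∈⁅w⁆⇒x≡w y∈⁅w⁆))))
    ... | inj₁ x∈⁅w⁆ | inj₂ y∈S rewrite x∈⁅w⁆⇒x≡w x∈⁅w⁆ =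
      λ Rwy → non-adjacent y∈S (x∈A∪B⁺ (successors w) (predecessors w) (inj₁ (fromWitness Rwy)))
    ... | inj₂ x∈S | inj₁ y∈⁅w⁆ rewrite x∈⁅w⁆⇒x≡w y∈⁅w⁆ =
      λ Rxw → non-adjacent x∈S (x∈A∪B⁺ (successors w) (predecessors w) (inj₂ (fromWitness Rxw)))
    ... | inj₂ x∈S | inj₂ y∈S = S-independent x∈S y∈S x≢y

    bound : ∣ A ∣ ≤ suc (2 * d) * ∣ ⁅ w ⁆ ∪ S ∣
    bound = begin
      ∣ A ∣                                  ≤⟨ ∣A∣≤1+degree+∣A─N[w]∣ A w ⟩
      suc (degree A w) + ∣ A′ ∣              ≤⟨ +-mono-≤ (s≤s deg≤2d) ∣A′∣≤ ⟩
      suc (2 * d) + suc (2 * d) * ∣ S ∣      ≡⟨ *-suc (suc (2 * d)) ∣ S ∣ ⟨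
      suc (2 * d) * (1 + ∣ S ∣)              ≡⟨ cong (λ k → suc (2 * d) * (k + ∣ S ∣)) (∣⁅w⁆∣≡1 w) ⟨
      suc (2 * d) * (∣ ⁅ w ⁆ ∣ + ∣ S ∣)      ≡⟨ cong (suc (2 * d) *_) (∣A∪B∣≡∣A∣+∣B∣ ⁅ w ⁆ S
                                                  (λ x∈⁅w⁆ → x∈⁅w⁆⇒x∉A─N[w] A w x∈⁅w⁆ ∘ S⊆A′)) ⟨
      suc (2 * d) * ∣ ⁅ w ⁆ ∪ S ∣            ∎

  independent-subset : ∀ A → ∃[ S ] LargeIndependentSubset A S
  independent-subset A = go A (<-wellFounded ∣ A ∣)
    where
    go : ∀ A → Acc _<_ ∣ A ∣ → ∃[ S ] LargeIndependentSubset A S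
    go A (acc smaller) with 0 <? ∣ A ∣
    ... | no ∣A∣≯0 = ∅ , (λ ()) , (λ ()) , ≤-trans (≮⇒≥ ∣A∣≯0) z≤n
    ... | yes ∣A∣>0 with low-degree-vertex A ∣A∣>0
    ...   | w , w∈A , deg≤2d =
      let S , large = go (A ─ closedNeighbourhood w) (smaller (∣A─N[w]∣<∣A∣ A w w∈A))
      in ⁅ w ⁆ ∪ S , add-vertex A w w∈A deg≤2d S large

-- The conflict digraph of the colouring

SameEdge-sym : ∀ {k} {a b a′ b′ : Fin k} → SameEdge a b a′ b′ → SameEdge a′ b′ a b
SameEdge-sym (inj₁ (refl , refl)) = inj₁ (refl , refl)
SameEdge-sym (inj₂ (refl , refl)) = inj₂ (refl , refl)

SameEdge-trans : ∀ {k} {a b a′ b′ a″ b″ : Fin k} →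
                 SameEdge a b a′ b′ → SameEdge a′ b′ a″ b″ → SameEdge a b a″ b″
SameEdge-trans (inj₁ (refl , refl)) e = e
SameEdge-trans (inj₂ (refl , refl)) (inj₁ (refl , refl)) = inj₂ (refl , refl)
SameEdge-trans (inj₂ (refl , refl)) (inj₂ (refl , refl)) = inj₁ (refl , refl)

module ConflictGraph {n : ℕ} (u v : Fin n)
                     (c : Fin n → Fin n → ℕ) (c-sym : ∀ i j → c i j ≡ c j i)
                     (inner-rainbow : RainbowEdges c (OutsideEdge u v))
                     (cross-rainbow : RainbowEdges c (CrossEdge u v)) where

  Endpoint Outside : Fin n → Set
  Endpoint x = x ≡ u ⊎ x ≡ v
  Outside  x = x ≢ u × x ≢ v

  outside? : ∀ x → Dec (Outside x)
  outside? x = ¬? (x ≟ u) ×-dec ¬? (x ≟ v)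

  endpoint≢outside : ∀ {x w} → Endpoint x → Outside w → x ≢ w
  endpoint≢outside (inj₁ refl) (w≢u , _) refl = w≢u refl
  endpoint≢outside (inj₂ refl) (_ , w≢v) refl = w≢v refl

  SameEdge-colour : ∀ {p q p′ q′} → SameEdge p q p′ q′ → c p q ≡ c p′ q′
  SameEdge-colour (inj₁ (refl , refl)) = refl
  SameEdge-colour (inj₂ (refl , refl)) = c-sym _ _

  cross-colour-injective : ∀ {x w x′ w′} → Endpoint x → Outside w → Endpoint x′ → Outside w′ →
                           c x w ≡ c x′ w′ → SameEdge x w x′ w′
  cross-colour-injective x-end w-out x′-end w′-out =
    cross-rainbow _ _ _ _ (endpoint≢outside x-end w-out) (endpoint≢outside x′-end w′-out)
                  (x-end , w-out) (x′-end , w′-out)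

  -- Clash x w z: z ≢ w is the designated endpoint of the inner edge coloured like the cross
  -- edge xw, namely the other endpoint if w lies on that edge and the smaller one otherwise.
  -- Designating a single endpoint keeps the out-degree of the conflict digraph at 2, not 4.
  Clash : Fin n → Fin n → Fin n → Set
  Clash x w z = z ≢ w × ∃[ y ] OutsideEdge u v z y × z ≢ y × c z y ≡ c x w × (y ≡ w ⊎ toℕ z < toℕ y)

  clash? : ∀ x w z → Dec (Clash x w z)
  clash? x w z = ¬? (z ≟ w) ×-dec any? λ y →
    (outside? z ×-dec outside? y) ×-dec ¬? (z ≟ y) ×-dec (c z y ℕ.≟ c x w) ×-dec
    (y ≟ w ⊎-dec toℕ z <? toℕ y)

  clash-unique : ∀ {x w z z′} → Clash x w z → Clash x w z′ → z ≡ z′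
  clash-unique (z≢w , y , out , z≢y , czy , y≡w⊎z<y) (z′≢w , y′ , out′ , z′≢y′ , cz′y′ , y′≡w⊎z′<y′)
    with inner-rainbow _ _ _ _ z≢y z′≢y′ out out′ (trans czy (sym cz′y′))
  ... | inj₁ (z≡z′ , _) = z≡z′
  ... | inj₂ (refl , refl) with y≡w⊎z<y | y′≡w⊎z′<y′
  ...   | inj₁ refl | _         = ⊥-elim (z′≢w refl)
  ...   | inj₂ _    | inj₁ refl = ⊥-elim (z≢w refl)
  ...   | inj₂ z<y  | inj₂ y<z  = ⊥-elim (<-asym z<y y<z)

  clash-of-equal-colour : ∀ {x w s t} → OutsideEdge u v s t → s ≢ t → c s t ≡ c x w →
                          ∃[ z ] Clash x w z × (z ≡ s ⊎ z ≡ t)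
  clash-of-equal-colour {w = w} {s} {t} (s-out , t-out) s≢t cst≡cxw with s ≟ w | t ≟ w
  ... | yes refl | _ = t , (t≢s , s , (t-out , s-out) , t≢s , trans (c-sym t s) cst≡cxw , inj₁ refl) , inj₂ refl
    where t≢s = s≢t ∘ sym
  ... | no s≢w | yes refl = s , (s≢w , t , (s-out , t-out) , s≢t , cst≡cxw , inj₁ refl) , inj₁ refl
  ... | no s≢w | no t≢w with Finₚ.<-cmp s t
  ...   | tri< s<t _ _ = s , (s≢w , t , (s-out , t-out) , s≢t , cst≡cxw , inj₂ s<t) , inj₁ refl
  ...   | tri≈ _ s≡t _ = ⊥-elim (s≢t s≡t)
  ...   | tri> _ _ t<s = t , (t≢w , s , (t-out , s-out) , s≢t ∘ sym , trans (c-sym t s) cst≡cxw , inj₂ t<s) , inj₂ refl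

  Conflict : Fin n → Fin n → Set
  Conflict w z = Clash u w z ⊎ Clash v w z

  conflict? : ∀ w z → Dec (Conflict w z)
  conflict? w = clash? u w ∪? clash? v w

  outdegree≤2 : ∀ w → ∣ ⌊_⌋ ∘ conflict? w ∣ ≤ 2
  outdegree≤2 w = ∣P∣≤a∧∣Q∣≤b⇒∣P∪Q∣≤a+b (clash? u w) (clash? v w)
                    (∣P∣≤1 (clash? u w) clash-unique) (∣P∣≤1 (clash? v w) clash-unique)

  CrossColouredUV InnerColouredUV : Fin n → Set
  CrossColouredUV w = Outside w × ∃[ x ] Endpoint x × c x w ≡ c u v
  InnerColouredUV w = Outside w × ∃[ y ] Outside y × toℕ w < toℕ y × c w y ≡ c u v

  crossColouredUV? : ∀ w → Dec (CrossColouredUV w)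
  crossColouredUV? w = outside? w ×-dec any? λ x → (x ≟ u ⊎-dec x ≟ v) ×-dec c x w ℕ.≟ c u v

  innerColouredUV? : ∀ w → Dec (InnerColouredUV w)
  innerColouredUV? w = outside? w ×-dec any? λ y → outside? y ×-dec toℕ w <? toℕ y ×-dec c w y ℕ.≟ c u v

  crossColouredUV-unique : ∀ {w w′} → CrossColouredUV w → CrossColouredUV w′ → w ≡ w′
  crossColouredUV-unique (w-out , x , x-end , cxw) (w′-out , x′ , x′-end , cx′w′)
    with cross-colour-injective x-end w-out x′-end w′-out (trans cxw (sym cx′w′))
  ... | inj₁ (_ , w≡w′) = w≡w′
  ... | inj₂ (_ , w≡x′) = ⊥-elim (endpoint≢outside x′-end w-out (sym w≡x′))

  innerColouredUV-unique : ∀ {w w′} → InnerColouredUV w → InnerColouredUV w′ → w ≡ w′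
  innerColouredUV-unique (w-out , y , y-out , w<y , cwy) (w′-out , y′ , y′-out , w′<y′ , cw′y′)
    with inner-rainbow _ _ _ _ (Finₚ.<⇒≢ w<y) (Finₚ.<⇒≢ w′<y′) (w-out , y-out) (w′-out , y′-out)
                       (trans cwy (sym cw′y′))
  ... | inj₁ (w≡w′ , _) = w≡w′
  ... | inj₂ (refl , refl) = ⊥-elim (<-asym w<y w′<y′)

  Bad : Fin n → Set
  Bad x = x ≡ u ⊎ x ≡ v ⊎ CrossColouredUV x ⊎ InnerColouredUV x

  bad? : ∀ x → Dec (Bad x)
  bad? = (_≟ u) ∪? (_≟ v) ∪? crossColouredUV? ∪? innerColouredUV?

  good : Fin n → Bool
  good = ∁ (⌊_⌋ ∘ bad?)

  n≤∣good∣+4 : n ≤ ∣ good ∣ + 4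
  n≤∣good∣+4 = begin
    n                               ≡⟨ ∣∁A∣+∣A∣≡N (⌊_⌋ ∘ bad?) ⟨
    ∣ good ∣ + ∣ ⌊_⌋ ∘ bad? ∣       ≤⟨ +-monoʳ-≤ ∣ good ∣ ∣bad∣≤4 ⟩
    ∣ good ∣ + 4                    ∎
    where
    open ≤-Reasoning
    ≡-unique : ∀ w {x y : Fin n} → x ≡ w → y ≡ w → x ≡ y
    ≡-unique _ x≡w y≡w = trans x≡w (sym y≡w)
    ∣bad∣≤4 : ∣ ⌊_⌋ ∘ bad? ∣ ≤ 4
    ∣bad∣≤4 =
      ∣P∣≤a∧∣Q∣≤b⇒∣P∪Q∣≤a+b (_≟ u) _ (∣P∣≤1 (_≟ u) (≡-unique u)) (
      ∣P∣≤a∧∣Q∣≤b⇒∣P∪Q∣≤a+b (_≟ v) _ (∣P∣≤1 (_≟ v) (≡-unique v)) (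
      ∣P∣≤a∧∣Q∣≤b⇒∣P∪Q∣≤a+b crossColouredUV? innerColouredUV?
        (∣P∣≤1 crossColouredUV? crossColouredUV-unique) (∣P∣≤1 innerColouredUV? innerColouredUV-unique)))

  good⇒¬Bad : ∀ {x} → x ∈ good → ¬ Bad x
  good⇒¬Bad x∈good = x∈∁A⁻ (⌊_⌋ ∘ bad?) x∈good ∘ fromWitness

  open BoundedOutdegree conflict? 2 outdegree≤2 using (Independent; independent-subset)

  module Clique (S : Fin n → Bool) (S⊆good : S ⊆ good) (S-independent : Independent S) where

    S-outside : ∀ {x} → x ∈ S → Outside x
    S-outside x∈S = (λ x≡u → ¬bad (inj₁ x≡u)) , (λ x≡v → ¬bad (inj₂ (inj₁ x≡v)))
      where ¬bad = good⇒¬Bad (S⊆good x∈S)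

    Member : Fin n → Set
    Member p = Endpoint p ⊎ p ∈ S

    data CliqueEdge (p q : Fin n) : Set where
      central : SameEdge p q u v → CliqueEdge p q
      cross   : ∀ {x w} → Endpoint x → w ∈ S → SameEdge p q x w → CliqueEdge p q
      inner   : p ∈ S → q ∈ S → CliqueEdge p q

    classify : ∀ {p q} → Member p → Member q → p ≢ q → CliqueEdge p q
    classify (inj₁ (inj₁ refl)) (inj₁ (inj₁ refl)) p≢q = ⊥-elim (p≢q refl)
    classify (inj₁ (inj₁ refl)) (inj₁ (inj₂ refl)) _   = central (inj₁ (refl , refl))
    classify (inj₁ (inj₂ refl)) (inj₁ (inj₁ refl)) _   = central (inj₂ (refl , refl))
    classify (inj₁ (inj₂ refl)) (inj₁ (inj₂ refl)) p≢q = ⊥-elim (p≢q refl)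
    classify (inj₁ p-end)       (inj₂ q∈S)         _   = cross p-end q∈S (inj₁ (refl , refl))
    classify (inj₂ p∈S)         (inj₁ q-end)       _   = cross q-end p∈S (inj₂ (refl , refl))
    classify (inj₂ p∈S)         (inj₂ q∈S)         _   = inner p∈S q∈S

    cross≢central : ∀ {x w} → Endpoint x → w ∈ S → c x w ≢ c u v
    cross≢central x-end w∈S cxw≡cuv =
      good⇒¬Bad (S⊆good w∈S) (inj₂ (inj₂ (inj₁ (S-outside w∈S , _ , x-end , cxw≡cuv))))

    S-not-inner-coloured : ∀ {x} → x ∈ S → ¬ InnerColouredUV x
    S-not-inner-coloured x∈S = good⇒¬Bad (S⊆good x∈S) ∘ inj₂ ∘ inj₂ ∘ inj₂

    inner≢central : ∀ {s t} → s ∈ S → t ∈ S → s ≢ t → c s t ≢ c u v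
    inner≢central {s} {t} s∈S t∈S s≢t cst≡cuv with Finₚ.<-cmp s t
    ... | tri< s<t _ _ = S-not-inner-coloured s∈S (S-outside s∈S , t , S-outside t∈S , s<t , cst≡cuv)
    ... | tri≈ _ s≡t _ = s≢t s≡t
    ... | tri> _ _ t<s =
      S-not-inner-coloured t∈S (S-outside t∈S , s , S-outside s∈S , t<s , trans (c-sym t s) cst≡cuv)

    cross≢inner : ∀ {x w s t} → Endpoint x → w ∈ S → s ∈ S → t ∈ S → s ≢ t → c x w ≢ c s t
    cross≢inner x-end w∈S s∈S t∈S s≢t cxw≡cst
      with clash-of-equal-colour (S-outside s∈S , S-outside t∈S) s≢t (sym cxw≡cst)
    ... | z , clash , z≡s⊎z≡t =
      S-independent w∈S z∈S (proj₁ clash ∘ sym) (conflict x-end)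
      where
      z∈S = [ (λ { refl → s∈S }) , (λ { refl → t∈S }) ] z≡s⊎z≡t
      conflict : Endpoint _ → Conflict _ z
      conflict (inj₁ refl) = inj₁ clash
      conflict (inj₂ refl) = inj₂ clash

    inner-colour-injective : ∀ {s t s′ t′} → s ∈ S → t ∈ S → s′ ∈ S → t′ ∈ S → s ≢ t → s′ ≢ t′ →
                             c s t ≡ c s′ t′ → SameEdge s t s′ t′
    inner-colour-injective s∈S t∈S s′∈S t′∈S s≢t s′≢t′ =
      inner-rainbow _ _ _ _ s≢t s′≢t′ (S-outside s∈S , S-outside t∈S) (S-outside s′∈S , S-outside t′∈S)

    same-colour⇒SameEdge : ∀ {p q p′ q′} → CliqueEdge p q → CliqueEdge p′ q′ → p ≢ q → p′ ≢ q′ →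
                           c p q ≡ c p′ q′ → SameEdge p q p′ q′
    same-colour⇒SameEdge (central e) (central e′) _ _ _ = SameEdge-trans e (SameEdge-sym e′)
    same-colour⇒SameEdge (central e) (cross x-end w∈S e′) _ _ eq =
      ⊥-elim (cross≢central x-end w∈S (trans (sym (SameEdge-colour e′)) (trans (sym eq) (SameEdge-colour e))))
    same-colour⇒SameEdge (central e) (inner s∈S t∈S) _ s≢t eq =
      ⊥-elim (inner≢central s∈S t∈S s≢t (trans (sym eq) (SameEdge-colour e)))
    same-colour⇒SameEdge (cross x-end w∈S e) (central e′) _ _ eq =
      ⊥-elim (cross≢central x-end w∈S (trans (sym (SameEdge-colour e)) (trans eq (SameEdge-colour e′))))
    same-colour⇒SameEdge (cross x-end w∈S e) (cross x′-end w′∈S e′) _ _ eq =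
      SameEdge-trans e (SameEdge-trans
        (cross-colour-injective x-end (S-outside w∈S) x′-end (S-outside w′∈S)
          (trans (sym (SameEdge-colour e)) (trans eq (SameEdge-colour e′))))
        (SameEdge-sym e′))
    same-colour⇒SameEdge (cross x-end w∈S e) (inner s∈S t∈S) _ s≢t eq =
      ⊥-elim (cross≢inner x-end w∈S s∈S t∈S s≢t (trans (sym (SameEdge-colour e)) eq))
    same-colour⇒SameEdge (inner s∈S t∈S) (central e′) s≢t _ eq =
      ⊥-elim (inner≢central s∈S t∈S s≢t (trans eq (SameEdge-colour e′)))
    same-colour⇒SameEdge (inner s∈S t∈S) (cross x-end w∈S e′) s≢t _ eq =
      ⊥-elim (cross≢inner x-end w∈S s∈S t∈S s≢t (trans (sym (SameEdge-colour e′)) (sym eq)))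
    same-colour⇒SameEdge (inner s∈S t∈S) (inner s′∈S t′∈S) s≢t s′≢t′ eq =
      inner-colour-injective s∈S t∈S s′∈S t′∈S s≢t s′≢t′ eq

    clique-rainbow : RainbowEdges c (λ p q → Member p × Member q)
    clique-rainbow p q p′ q′ p≢q p′≢q′ (p∈ , q∈) (p′∈ , q′∈) =
      same-colour⇒SameEdge (classify p∈ q∈ p≢q) (classify p′∈ q′∈ p′≢q′) p≢q p′≢q′

  large-rainbow-clique :
    ∃[ S ] (∀ {x} → x ∈ S → Outside x) ×
           RainbowEdges c (λ p q → (Endpoint p ⊎ p ∈ S) × (Endpoint q ⊎ q ∈ S)) ×
           n ≤ 5 * ∣ S ∣ + 4
  large-rainbow-clique with independent-subset good
  ... | S , S⊆good , S-independent , ∣good∣≤5∣S∣ =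
    S , S-outside , clique-rainbow , ≤-trans n≤∣good∣+4 (+-monoˡ-≤ 4 ∣good∣≤5∣S∣)
    where open Clique S S⊆good S-independent

-- Embedding H

module _ {m n : ℕ} {f : Fin m → Fin n} {i : Fin m} {y : Fin n} where

  updateAt-injective : Injective _≡_ _≡_ f → (∀ {x} → x ≢ i → f x ≢ y) →
                       Injective _≡_ _≡_ (updateAt f i (const y))
  updateAt-injective f-injective y-fresh {x} {x′} eq with x ≟ i | x′ ≟ i
  ... | yes refl | yes refl = refl
  ... | yes refl | no x′≢i  =
    ⊥-elim (y-fresh x′≢i (trans (sym (updateAt-minimal x′ i f x′≢i)) (trans (sym eq) (updateAt-updates i f))))
  ... | no x≢i   | yes refl =
    ⊥-elim (y-fresh x≢i (trans (sym (updateAt-minimal x i f x≢i)) (trans eq (updateAt-updates i f))))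
  ... | no x≢i   | no x′≢i  =
    f-injective (trans (sym (updateAt-minimal x i f x≢i)) (trans eq (updateAt-minimal x′ i f x′≢i)))

  updateAt-preserves : ∀ (P : Fin n → Set) → (∀ x → P (f x)) → P y → ∀ x → P (updateAt f i (const y) x)
  updateAt-preserves P Pf Py x with x ≟ i
  ... | yes refl = subst P (sym (updateAt-updates i f)) Py
  ... | no x≢i   = subst P (sym (updateAt-minimal x i f x≢i)) (Pf x)

SameEdge-injective : ∀ {m n} {φ : Fin m → Fin n} → Injective _≡_ _≡_ φ →
                     ∀ {a b a′ b′} → SameEdge (φ a) (φ b) (φ a′) (φ b′) → SameEdge a b a′ b′
SameEdge-injective φ-injective = Sum.map (Product.map φ-injective φ-injective) (Product.map φ-injective φ-injective)

rainbow-copy-through : ∀ {m n} (H : SimpleGraph m) → HasEdge H →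
  {c : Fin n → Fin n → ℕ} {K : Fin n → Set} → RainbowEdges c (λ p q → K p × K q) →
  {u v : Fin n} → u ≢ v → K u → K v →
  (g : Fin m → Fin n) → Injective _≡_ _≡_ g → (∀ x → K (g x) × g x ≢ u × g x ≢ v) →
  RainbowCopyThrough H c u v
rainbow-copy-through {m} {n} H (a , b , ab) {c} {K} K-rainbow {u} {v} u≢v Ku Kv g g-injective g-fresh =
  φ , φ-injective , rainbow , a , b , ab , φa≡u , updateAt-updates b ψ
  where
  ψ φ : Fin m → Fin n
  ψ = updateAt g a (const u)
  φ = updateAt ψ b (const v)

  ψ-injective : Injective _≡_ _≡_ ψ
  ψ-injective = updateAt-injective g-injective (λ _ → proj₁ (proj₂ (g-fresh _)))

  ψ≢v : ∀ x → ψ x ≢ v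
  ψ≢v = updateAt-preserves (_≢ v) (proj₂ ∘ proj₂ ∘ g-fresh) u≢v

  φ-injective : Injective _≡_ _≡_ φ
  φ-injective = updateAt-injective ψ-injective (λ {x} _ → ψ≢v x)

  φ∈K : ∀ x → K (φ x)
  φ∈K = updateAt-preserves K (updateAt-preserves K (proj₁ ∘ g-fresh) Ku) Kv

  φa≡u : φ a ≡ u
  φa≡u = trans (updateAt-minimal a b ψ (λ { refl → irrefl H ab })) (updateAt-updates a g)

  φ-distinct : ∀ {x y} → Adj H x y → φ x ≢ φ y
  φ-distinct {x} xy φx≡φy = irrefl H (subst (Adj H x) (sym (φ-injective φx≡φy)) xy)

  rainbow : ∀ x y x′ y′ → Adj H x y → Adj H x′ y′ → c (φ x) (φ y) ≡ c (φ x′) (φ y′) → SameEdge x y x′ y′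
  rainbow x y x′ y′ xy x′y′ same-colour = SameEdge-injective φ-injective
    (K-rainbow _ _ _ _ (φ-distinct xy) (φ-distinct x′y′) (φ∈K x , φ∈K y) (φ∈K x′ , φ∈K y′) same-colour)

*-cancelˡ-≤-slack : ∀ k {m s} → suc k * m ≤ suc k * s + k → m ≤ s
*-cancelˡ-≤-slack k {m} {s} bound with m ≤? s
... | yes m≤s = m≤s
... | no  m≰s = ⊥-elim (<-irrefl refl (begin-strict
  suc k * suc s      ≤⟨ *-monoʳ-≤ (suc k) (≰⇒> m≰s) ⟩
  suc k * m          ≤⟨ bound ⟩
  suc k * s + k      <⟨ +-monoʳ-< (suc k * s) (n<1+n k) ⟩
  suc k * s + suc k  ≡⟨ +-comm (suc k * s) (suc k) ⟩
  suc k + suc k * s  ≡⟨ *-suc (suc k) s ⟨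
  suc k * suc s      ∎))
  where open ≤-Reasoning

corollary2p3 : ∀ {m} (H : SimpleGraph m) → HasEdge H →
    (n : ℕ) → 5 * m ≤ n →
    (u v : Fin n) → u ≢ v →
    (col : SymColouring n) →
    RainbowEdges (proj₁ col) (OutsideEdge u v) →
    RainbowEdges (proj₁ col) (CrossEdge u v) →
    RainbowCopyThrough H (proj₁ col) u v
corollary2p3 {m} H H-edge n 5m≤n u v u≢v (c , c-sym) inner-rainbow cross-rainbow
  with ConflictGraph.large-rainbow-clique u v c c-sym inner-rainbow cross-rainbow
... | S , S-outside , clique-rainbow , n≤5∣S∣+4
  with m≤∣S∣⇒injection S (*-cancelˡ-≤-slack 4 (≤-trans 5m≤n n≤5∣S∣+4))
... | g , g-injective , g∈S =
  rainbow-copy-through H H-edge clique-rainbow u≢v (inj₁ (inj₁ refl)) (inj₁ (inj₂ refl))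
    g g-injective (λ x → inj₂ (g∈S x) , S-outside (g∈S x))
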